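{- Let $y=\tan x$, $z=\sec x$ and $D=d/dx$. Define the operator powers $(Dy)^n$ by $(Dy)^0(f)=f$ and $(Dy)^{n+1}(f)=D\big(y\,(Dy)^n(f)\big)$. For $n\ge1$ let $A(n,k)$ denote the Eulerian numbers. Then for every $n\ge 1$, $$(Dy)^n(y+z)=(y+z)^{n+1}\sum_{k=1}^nA(n,k)\,y^{n-k}z^k.$$
   Context: The Eulerian numbers are defined by $\sum_{\pi\in S_n}x^{\mathrm{des}(\pi)+1}=\sum_{k=1}^nA(n,k)x^k$, where $S_n$ is the symmetric group on $\{1,\dots,n\}$ and $\mathrm{des}(\pi)$ is the number of positions $i\in\{1,\dots,n-1\}$ with $\pi(i)>\pi(i+1)$. Equivalently $A(n,k)$ is the number of permutations of $[n]$ with exactly $k-1$ descents. -}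

module Defs where

open import Level using (_⊔_)
open import Data.Nat as ℕ using (ℕ; zero; suc; _<ᵇ_; _∸_)
open import Data.Bool using (if_then_else_)
open import Data.List using (List; []; _∷_; concatMap; length; filter; map)
open import Data.Nat.Properties using (_≟_)
open import Algebra.Bundles using (CommutativeRing)
open import Relation.Binary.PropositionalEquality using (_≡_)

insertions : ℕ → List ℕ → List (List ℕ)
insertions x []       = (x ∷ []) ∷ []
insertions x (a ∷ l)  = (x ∷ a ∷ l) ∷ map (a ∷_) (insertions x l)

perms : ℕ → List (List ℕ)
perms zero    = [] ∷ []
perms (suc n) = concatMap (insertions (suc n)) (perms n)

des : List ℕ → ℕ
des []            = 0
des (a ∷ [])      = 0
des (a ∷ b ∷ l)   = (if b <ᵇ a then 1 else 0) ℕ.+ des (b ∷ l)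

eulerian : ℕ → ℕ → ℕ
eulerian n k = length (filter (λ π → suc (des π) ≟ k) (perms n))

record Derivation {c ℓ} (R : CommutativeRing c ℓ) : Set (c ⊔ ℓ) where
  open CommutativeRing R
  field
    D      : Carrier → Carrier
    D-cong : ∀ {a b} → a ≈ b → D a ≈ D b
    D-+    : ∀ a b → D (a + b) ≈ D a + D b
    D-*    : ∀ a b → D (a * b) ≈ D a * b + a * D b

module _ {c ℓ} (R : CommutativeRing c ℓ) where
  open CommutativeRing R

  pow : Carrier → ℕ → Carrier
  pow x zero    = 1#
  pow x (suc n) = x * pow x n

  scale : ℕ → Carrier → Carrier
  scale zero    x = 0#
  scale (suc n) x = x + scale n x

  sum1 : ℕ → (ℕ → Carrier) → Carrier
  sum1 zero    f = 0#
  sum1 (suc n) f = sum1 n f + f (suc n)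

  Dy^ : (D : Carrier → Carrier) → Carrier → ℕ → Carrier → Carrier
  Dy^ D y zero    f = f
  Dy^ D y (suc n) f = D (y * Dy^ D y n f)

module Submission where

-- Write w = y + z.  From D y = z² and D z = y z one gets D w = z w, so the operator (Dy)
-- acts on w^k · X as w^k · E_k X with the additive operator E_k X = z² X + k·yz X + y·D X.
-- On a monomial, E_(1+r+s) (y^r z^s) = w · (s·y^(r+1) z^s + (r+1)·y^r z^(s+1)).  The two
-- coefficients are exactly what inserting the maximal letter n+1 into a permutation π of
-- {1,…,n} with d descents produces: d + 1 insertions keep d descents, the other n - d create
-- one more.  Hence the descent polynomial P_n = Σ_{π ∈ S_n} y^(n-k) z^k (k = des π + 1)
-- satisfies E_(n+1) P_n = w · P_(n+1), and induction gives (Dy)^n w = w^(n+1) · P_n.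
-- Grouping P_n by the value of k finally yields Σ_k A(n,k) y^(n-k) z^k.

open import Defs
open import Level using (Level)
open import Data.Nat as ℕ using (ℕ; zero; suc; _∸_; _≤_; _<_; _≥_; _<ᵇ_; z≤n; s≤s)
open import Data.Nat.Properties
  using (_≟_; ≤-refl; ≤-trans; ≤-pred; m≤n⇒m≤1+n; m<n⇒m<1+n; n<1+n; <⇒≤; <⇒≢; <⇒<ᵇ;
         m≤n⇒m<n∨m≡n; suc-injective; +-∸-assoc; m+[n∸m]≡n; +-comm; +-suc)
open import Data.Bool using (Bool; true; false; if_then_else_)
open import Data.Bool.Properties using (T-≡)
open import Data.List using (List; []; _∷_; _++_; map; concatMap; length; filter)
open import Data.List.Relation.Unary.All as All using (All; []; _∷_)
import Data.List.Relation.Unary.All.Properties as All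
open import Data.Product using (_,_) renaming (_×_ to _∧_)
open import Data.Sum using (inj₁; inj₂)
open import Function.Bundles using (Equivalence)
open import Relation.Nullary using (does)
open import Relation.Nullary.Decidable using (dec-true; dec-false)
open import Relation.Nullary.Negation using (contradiction)
open import Relation.Binary.PropositionalEquality as ≡ using (_≡_; _≢_)
open import Algebra.Bundles using (CommutativeMonoid; CommutativeRing)

bit : Bool → ℕ
bit β = if β then 1 else 0

<ᵇ-true : ∀ {m n} → m < n → (m <ᵇ n) ≡ true
<ᵇ-true m<n = Equivalence.to T-≡ (<⇒<ᵇ m<n)

<ᵇ-false : ∀ {m n} → n ≤ m → (m <ᵇ n) ≡ false
<ᵇ-false {m}     {zero}  _         = ≡.refl
<ᵇ-false {suc m} {suc n} (s≤s n≤m) = <ᵇ-false n≤m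

des-peak : ∀ {a x b} l → a < x → b < x → des (a ∷ x ∷ b ∷ l) ≡ suc (des (b ∷ l))
des-peak {a} {x} l a<x b<x rewrite <ᵇ-false {x} {a} (<⇒≤ a<x) | <ᵇ-true b<x = ≡.refl

des-front : ∀ {x a} l → a < x → des (x ∷ a ∷ l) ≡ suc (des (a ∷ l))
des-front l a<x rewrite <ᵇ-true a<x = ≡.refl

des-end : ∀ {a x} → a < x → des (a ∷ x ∷ []) ≡ 0
des-end {a} {x} a<x rewrite <ᵇ-false {x} {a} (<⇒≤ a<x) = ≡.refl

des-bound : ∀ b l → des (b ∷ l) ≤ length l
des-bound b []      = z≤n
des-bound b (c ∷ l) with c <ᵇ b
... | true  = s≤s (des-bound c l)
... | false = m≤n⇒m≤1+n (des-bound c l)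

-- The lists in perms n have length n and entries in {1,…,n}; only the upper bound is needed.
PermShape : ℕ → List ℕ → Set
PermShape n π = length π ≡ n ∧ All (_< suc n) π

insertions-shape : ∀ x l → All (_< x) l →
  All (λ m → length m ≡ suc (length l) ∧ All (_< suc x) m) (insertions x l)
insertions-shape x []      []          = (≡.refl , n<1+n x ∷ []) ∷ []
insertions-shape x (a ∷ l) (a<x ∷ l<x) =
  (≡.refl , n<1+n x ∷ m<n⇒m<1+n a<x ∷ All.map m<n⇒m<1+n l<x)
  ∷ All.map⁺ (All.map (λ { (len , m<) → ≡.cong suc len , m<n⇒m<1+n a<x ∷ m< })
                      (insertions-shape x l l<x))

perms-shape : ∀ n → All (PermShape n) (perms n)
perms-shape zero    = (≡.refl , []) ∷ []
perms-shape (suc n) = All.concat⁺ (All.map⁺ (All.map grow (perms-shape n)))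
  where
  grow : ∀ {π} → PermShape n π → All (PermShape (suc n)) (insertions (suc n) π)
  grow (len , π<) = All.map (λ { (len′ , m<) → ≡.trans len′ (≡.cong suc len) , m< })
                            (insertions-shape (suc n) _ π<)

des≤ : ∀ π {n} → length π ≡ suc n → des π ≤ n
des≤ (b ∷ l) len = ≡.subst (des (b ∷ l) ≤_) (suc-injective len) (des-bound b l)

∸-split : ∀ {d m} → d ≤ m → (m ∸ d) ℕ.+ suc d ≡ suc m
∸-split {d} {m} d≤m = ≡.trans (+-suc (m ∸ d) d) (≡.cong suc (≡.trans (+-comm (m ∸ d) d) (m+[n∸m]≡n d≤m)))

module ListSum {c ℓ} (M : CommutativeMonoid c ℓ) where
  open CommutativeMonoid M
  open import Algebra.Properties.Monoid.Mult monoid using (_×_)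
  open import Algebra.Properties.CommutativeSemigroup commutativeSemigroup using (x∙yz≈y∙xz)
  open import Relation.Binary.Reasoning.Setoid setoid

  ∑ : {A : Set} → List A → (A → Carrier) → Carrier
  ∑ []       f = ε
  ∑ (a ∷ as) f = f a ∙ ∑ as f

  ∑-cong : ∀ {A : Set} {L : List A} {f g : A → Carrier} → All (λ a → f a ≈ g a) L → ∑ L f ≈ ∑ L g
  ∑-cong []       = refl
  ∑-cong (p ∷ ps) = ∙-cong p (∑-cong ps)

  ∑-map : ∀ {A B : Set} (h : A → B) (L : List A) (f : B → Carrier) → ∑ (map h L) f ≡ ∑ L (λ a → f (h a))
  ∑-map h []       f = ≡.refl
  ∑-map h (a ∷ as) f = ≡.cong (f (h a) ∙_) (∑-map h as f)

  ∑-++ : ∀ {A : Set} (K L : List A) (f : A → Carrier) → ∑ (K ++ L) f ≈ ∑ K f ∙ ∑ L f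
  ∑-++ []       L f = sym (identityˡ _)
  ∑-++ (a ∷ as) L f = trans (∙-congˡ (∑-++ as L f)) (sym (assoc _ _ _))

  ∑-concatMap : ∀ {A B : Set} (g : A → List B) (L : List A) (f : B → Carrier) →
    ∑ (concatMap g L) f ≈ ∑ L (λ a → ∑ (g a) f)
  ∑-concatMap g []       f = refl
  ∑-concatMap g (a ∷ as) f = trans (∑-++ (g a) (concatMap g as) f) (∙-congˡ (∑-concatMap g as f))

  ∑-homo : ∀ (h : Carrier → Carrier) → (∀ a b → h (a ∙ b) ≈ h a ∙ h b) → h ε ≈ ε →
    ∀ {A : Set} (L : List A) (f : A → Carrier) → h (∑ L f) ≈ ∑ L (λ a → h (f a))
  ∑-homo h h-∙ h-ε []       f = h-ε
  ∑-homo h h-∙ h-ε (a ∷ as) f = trans (h-∙ (f a) (∑ as f)) (∙-congˡ (∑-homo h h-∙ h-ε as f))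

  -- Bookkeeping behind one step of the insertion count: if the letter after the insertion
  -- point forms a descent (β = true) every count shifts by one; otherwise the new first
  -- slot adds one ascent.
  absorb-slot : ∀ β (F : ℕ → Carrier) e n → e ≤ n →
    F (suc e) ∙ (suc e × F (bit β ℕ.+ e) ∙ (n ∸ e) × F (bit β ℕ.+ suc e))
      ≈ suc (bit β ℕ.+ e) × F (bit β ℕ.+ e) ∙ (suc n ∸ (bit β ℕ.+ e)) × F (suc (bit β ℕ.+ e))
  absorb-slot true  F e n _   = sym (assoc _ _ _)
  absorb-slot false F e n e≤n = begin
    F (suc e) ∙ (suc e × F e ∙ (n ∸ e) × F (suc e)) ≈⟨ x∙yz≈y∙xz _ _ _ ⟩
    suc e × F e ∙ suc (n ∸ e) × F (suc e)
      ≡⟨ ≡.cong (λ k → suc e × F e ∙ k × F (suc e)) (≡.sym (+-∸-assoc 1 e≤n)) ⟩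
    suc e × F e ∙ (suc n ∸ e) × F (suc e) ∎

  ∑-insert-behind : ∀ (F : ℕ → Carrier) x a l → a < x → All (_< x) l →
    ∑ (insertions x l) (λ m → F (des (a ∷ m)))
      ≈ suc (des (a ∷ l)) × F (des (a ∷ l)) ∙ (length l ∸ des (a ∷ l)) × F (suc (des (a ∷ l)))
  ∑-insert-behind F x a []      a<x [] = begin
    F (des (a ∷ x ∷ [])) ∙ ε ≡⟨ ≡.cong (λ t → F t ∙ ε) (des-end a<x) ⟩
    F 0 ∙ ε                  ≈⟨ sym (identityʳ _) ⟩
    (F 0 ∙ ε) ∙ ε            ∎
  ∑-insert-behind F x a (b ∷ l) a<x (b<x ∷ l<x) = begin
    F (des (a ∷ x ∷ b ∷ l)) ∙ ∑ (map (b ∷_) (insertions x l)) (λ m → F (des (a ∷ m)))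
      ≡⟨ ≡.cong₂ _∙_ (≡.cong F (des-peak l a<x b<x)) (∑-map (b ∷_) (insertions x l) _) ⟩
    F (suc e) ∙ ∑ (insertions x l) (λ m → F′ (des (b ∷ m)))
      ≈⟨ ∙-congˡ (∑-insert-behind F′ x b l b<x l<x) ⟩
    F (suc e) ∙ (suc e × F′ e ∙ (length l ∸ e) × F′ (suc e))
      ≈⟨ absorb-slot (b <ᵇ a) F e (length l) (des-bound b l) ⟩
    suc e′ × F e′ ∙ (suc (length l) ∸ e′) × F (suc e′) ∎
    where
    e  = des (b ∷ l)
    e′ = des (a ∷ b ∷ l)
    F′ : ℕ → Carrier
    F′ t = F (bit (b <ᵇ a) ℕ.+ t)

  ∑-insert-max : ∀ (F : ℕ → Carrier) x l → All (_< x) l →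
    ∑ (insertions x l) (λ m → F (des m))
      ≈ suc (des l) × F (des l) ∙ (length l ∸ des l) × F (suc (des l))
  ∑-insert-max F x []      []          = sym (identityʳ _)
  ∑-insert-max F x (a ∷ l) (a<x ∷ l<x) = begin
    F (des (x ∷ a ∷ l)) ∙ ∑ (map (a ∷_) (insertions x l)) (λ m → F (des m))
      ≡⟨ ≡.cong₂ _∙_ (≡.cong F (des-front l a<x)) (∑-map (a ∷_) (insertions x l) _) ⟩
    F (suc e) ∙ ∑ (insertions x l) (λ m → F (des (a ∷ m)))
      ≈⟨ ∙-congˡ (∑-insert-behind F x a l a<x l<x) ⟩
    F (suc e) ∙ (suc e × F e ∙ (length l ∸ e) × F (suc e))
      ≈⟨ absorb-slot false F e (length l) (des-bound a l) ⟩
    suc e × F e ∙ (suc (length l) ∸ e) × F (suc e) ∎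
    where e = des (a ∷ l)

fibreSize : {A : Set} → (A → ℕ) → ℕ → List A → ℕ
fibreSize f k L = length (filter (λ a → f a ≟ k) L)

module Fibres {c ℓ} (R : CommutativeRing c ℓ) where
  open CommutativeRing R
  open ListSum +-commutativeMonoid using (∑)
  open import Algebra.Properties.CommutativeSemigroup +-commutativeSemigroup using (interchange)
  open import Relation.Binary.Reasoning.Setoid setoid

  select : ℕ → ℕ → Carrier → Carrier
  select j k x = if does (j ≟ k) then x else 0#

  select-≢ : ∀ {j k} x → j ≢ k → select j k x ≡ 0#
  select-≢ {j} {k} x j≢k rewrite dec-false (j ≟ k) j≢k = ≡.refl

  select-≡ : ∀ j x → select j j x ≡ x
  select-≡ j x rewrite dec-true (j ≟ j) ≡.refl = ≡.refl

  sum1-cong : ∀ n {f g : ℕ → Carrier} → (∀ k → f k ≈ g k) → sum1 R n f ≈ sum1 R n g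
  sum1-cong zero    f≈g = refl
  sum1-cong (suc n) f≈g = +-cong (sum1-cong n f≈g) (f≈g (suc n))

  sum1-0 : ∀ n → sum1 R n (λ _ → 0#) ≈ 0#
  sum1-0 zero    = refl
  sum1-0 (suc n) = trans (+-identityʳ _) (sum1-0 n)

  sum1-+ : ∀ n (f g : ℕ → Carrier) → sum1 R n (λ k → f k + g k) ≈ sum1 R n f + sum1 R n g
  sum1-+ zero    f g = sym (+-identityʳ 0#)
  sum1-+ (suc n) f g = trans (+-congʳ (sum1-+ n f g)) (interchange _ _ _ _)

  sum1-select-above : ∀ n j (g : ℕ → Carrier) → n < j → sum1 R n (λ k → select j k (g k)) ≈ 0#
  sum1-select-above zero    j g _   = refl
  sum1-select-above (suc n) j g n<j = begin
    sum1 R n (λ k → select j k (g k)) + select j (suc n) (g (suc n))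
      ≈⟨ +-cong (sum1-select-above n j g (<⇒≤ n<j))
                (reflexive (select-≢ _ (λ j≡ → <⇒≢ n<j (≡.sym j≡)))) ⟩
    0# + 0# ≈⟨ +-identityʳ 0# ⟩
    0# ∎

  sum1-select : ∀ n j (g : ℕ → Carrier) → 1 ≤ j → j ≤ n → sum1 R n (λ k → select j k (g k)) ≈ g j
  sum1-select zero    j g 1≤j j≤0 = contradiction (≤-trans 1≤j j≤0) λ ()
  sum1-select (suc n) j g 1≤j j≤n with m≤n⇒m<n∨m≡n j≤n
  ... | inj₁ j<n    = trans (+-cong (sum1-select n j g 1≤j (≤-pred j<n)) (reflexive (select-≢ _ (<⇒≢ j<n))))
                            (+-identityʳ _)
  ... | inj₂ ≡.refl = trans (+-cong (sum1-select-above n j g ≤-refl) (reflexive (select-≡ j _)))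
                            (+-identityˡ _)

  -- Putting a in front of L enlarges exactly the fibre over f a (the test f a ≟ k of the
  -- filter computes by the boolean equality f a ≡ᵇ k).
  fibre-cons : ∀ {A : Set} (f : A → ℕ) k a L x →
    scale R (fibreSize f k (a ∷ L)) x ≈ select (f a) k x + scale R (fibreSize f k L) x
  fibre-cons f k a L x with f a ℕ.≡ᵇ k
  ... | true  = refl
  ... | false = sym (+-identityˡ _)

  ∑-by-fibres : ∀ {A : Set} n (f : A → ℕ) (g : ℕ → Carrier) (L : List A) →
    All (λ a → 1 ≤ f a ∧ f a ≤ n) L →
    ∑ L (λ a → g (f a)) ≈ sum1 R n (λ k → scale R (fibreSize f k L) (g k))
  ∑-by-fibres n f g []      []                         = sym (sum1-0 n)
  ∑-by-fibres n f g (a ∷ L) ((1≤fa , fa≤n) ∷ bounds) = begin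
    g (f a) + ∑ L (λ a → g (f a))
      ≈⟨ +-cong (sym (sum1-select n (f a) g 1≤fa fa≤n)) (∑-by-fibres n f g L bounds) ⟩
    sum1 R n (λ k → select (f a) k (g k)) + sum1 R n (λ k → scale R (fibreSize f k L) (g k))
      ≈⟨ sym (sum1-+ n _ _) ⟩
    sum1 R n (λ k → select (f a) k (g k) + scale R (fibreSize f k L) (g k))
      ≈⟨ sum1-cong n (λ k → sym (fibre-cons f k a L (g k))) ⟩
    sum1 R n (λ k → scale R (fibreSize f k (a ∷ L)) (g k)) ∎

module Derivations {c ℓ} (R : CommutativeRing c ℓ) (δ : Derivation R) where
  open CommutativeRing R
  open Derivation δ
  open import Algebra.Properties.Group +-group using (identityˡ-unique)
  open import Algebra.Properties.CommutativeSemigroup *-commutativeSemigroup using (x∙yz≈y∙xz)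
  open import Algebra.Properties.Semiring.Mult semiring using (_×_; ×-congʳ; ×-comm-*)
  open import Relation.Binary.Reasoning.Setoid setoid

  -- Constants are annihilated: D 0 and D 1 both satisfy c + c = c.
  D-0# : D 0# ≈ 0#
  D-0# = identityˡ-unique (D 0#) (D 0#) (sym (trans (D-cong (sym (+-identityʳ 0#))) (D-+ 0# 0#)))

  D-1# : D 1# ≈ 0#
  D-1# = identityˡ-unique (D 1#) (D 1#) (sym (begin
    D 1#                  ≈⟨ D-cong (sym (*-identityʳ 1#)) ⟩
    D (1# * 1#)           ≈⟨ D-* 1# 1# ⟩
    D 1# * 1# + 1# * D 1# ≈⟨ +-cong (*-identityʳ _) (*-identityˡ _) ⟩
    D 1# + D 1#           ∎))

  -- The power rule, multiplied through by x so that no power x^(k-1) is needed.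
  x*D-pow : ∀ x k → x * D (pow R x k) ≈ k × (D x * pow R x k)
  x*D-pow x zero    = trans (*-congˡ D-1#) (zeroʳ x)
  x*D-pow x (suc k) = begin
    x * D (x * X)                       ≈⟨ *-congˡ (D-* x X) ⟩
    x * (D x * X + x * D X)             ≈⟨ distribˡ x _ _ ⟩
    x * (D x * X) + x * (x * D X)       ≈⟨ +-cong (x∙yz≈y∙xz x (D x) X) (*-congˡ (x*D-pow x k)) ⟩
    D x * (x * X) + x * (k × (D x * X)) ≈⟨ +-congˡ (×-comm-* k x _) ⟩
    D x * (x * X) + k × (x * (D x * X)) ≈⟨ +-congˡ (×-congʳ k (x∙yz≈y∙xz x (D x) X)) ⟩
    D x * (x * X) + k × (D x * (x * X)) ∎
    where X = pow R x k

  D-pow-eigen : ∀ {x u} → D x ≈ u * x → ∀ k → D (pow R x k) ≈ k × (u * pow R x k)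
  D-pow-eigen Dx zero = D-1#
  D-pow-eigen {x} {u} Dx (suc k) = begin
    D (x * X)                     ≈⟨ D-* x X ⟩
    D x * X + x * D X             ≈⟨ +-cong (*-congʳ Dx) (*-congˡ (D-pow-eigen Dx k)) ⟩
    u * x * X + x * (k × (u * X)) ≈⟨ +-cong (*-assoc u x X) (×-comm-* k x _) ⟩
    u * (x * X) + k × (x * (u * X)) ≈⟨ +-congˡ (×-congʳ k (x∙yz≈y∙xz x u X)) ⟩
    u * (x * X) + k × (u * (x * X)) ∎
    where X = pow R x k

module TanSec {c ℓ} (R : CommutativeRing c ℓ) (δ : Derivation R) where
  open CommutativeRing R
  open Derivation δ
  open Derivations R δ
  open ListSum +-commutativeMonoid using (∑; ∑-cong; ∑-concatMap; ∑-homo; ∑-insert-max)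
  open Fibres R using (∑-by-fibres)
  open import Algebra.Properties.CommutativeSemigroup *-commutativeSemigroup using (x∙yz≈yx∙z)
  open import Algebra.Properties.Semiring.Mult semiring using (_×_; ×-congʳ; ×-assoc-*; ×-homo-+)
  open import Algebra.Solver.Ring.NaturalCoefficients.Default commutativeSemiring
  open import Relation.Binary.Reasoning.Setoid setoid

  fromℕ : ℕ → Carrier
  fromℕ k = k × 1#

  ×≈fromℕ* : ∀ k a → k × a ≈ fromℕ k * a
  ×≈fromℕ* k a = sym (trans (×-assoc-* k 1# a) (×-congʳ k (*-identityˡ a)))

  module Identities (y z : Carrier) (D-y : D y ≈ z * z) (D-z : D z ≈ y * z) where
    w : Carrier
    w = y + z

    D-w : D w ≈ z * w
    D-w = begin
      D (y + z)     ≈⟨ D-+ y z ⟩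
      D y + D z     ≈⟨ +-cong D-y D-z ⟩
      z * z + y * z ≈⟨ solve 2 (λ y z → z :* z :+ y :* z := z :* (y :+ z)) refl y z ⟩
      z * w         ∎

    mon : ℕ → ℕ → Carrier
    mon n k = pow R y (n ∸ k) * pow R z k

    P : ℕ → Carrier
    P n = ∑ (perms n) (λ π → mon n (suc (des π)))

    E : ℕ → Carrier → Carrier
    E k X = z * z * X + fromℕ k * (y * z * X) + y * D X

    Dy-on-w^k : ∀ k X → D (y * (pow R w k * X)) ≈ pow R w k * E k X
    Dy-on-w^k k X = begin
      D (y * (W * X))                           ≈⟨ D-* y (W * X) ⟩
      D y * (W * X) + y * D (W * X)             ≈⟨ +-cong (*-congʳ D-y) (*-congˡ (D-* W X)) ⟩
      z * z * (W * X) + y * (D W * X + W * D X)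
        ≈⟨ +-congˡ (*-congˡ (+-congʳ (*-congʳ (trans (D-pow-eigen D-w k) (×≈fromℕ* k _))))) ⟩
      z * z * (W * X) + y * (fromℕ k * (z * W) * X + W * D X)
        ≈⟨ solve 6 (λ y z W X DX K →
             z :* z :* (W :* X) :+ y :* (K :* (z :* W) :* X :+ W :* DX)
             := W :* (z :* z :* X :+ K :* (y :* z :* X) :+ y :* DX)) refl y z W X (D X) (fromℕ k) ⟩
      W * E k X ∎
      where W = pow R w k

    E-additive : ∀ k a b → E k (a + b) ≈ E k a + E k b
    E-additive k a b = trans (+-congˡ (*-congˡ (D-+ a b)))
      (solve 7 (λ y z K a b Da Db →
         z :* z :* (a :+ b) :+ K :* (y :* z :* (a :+ b)) :+ y :* (Da :+ Db)
         := (z :* z :* a :+ K :* (y :* z :* a) :+ y :* Da) :+ (z :* z :* b :+ K :* (y :* z :* b) :+ y :* Db))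
         refl y z (fromℕ k) a b (D a) (D b))

    E-0# : ∀ k → E k 0# ≈ 0#
    E-0# k = trans (+-congˡ (*-congˡ D-0#))
      (solve 3 (λ y z K → z :* z :* con 0 :+ K :* (y :* z :* con 0) :+ y :* con 0 := con 0)
         refl y z (fromℕ k))

    y*D-monomial : ∀ r s →
      y * D (pow R y r * pow R z s)
        ≈ fromℕ r * (z * z * (pow R y r * pow R z s)) + fromℕ s * (y * y * (pow R y r * pow R z s))
    y*D-monomial r s = begin
      y * D (Y * Z)               ≈⟨ *-congˡ (D-* Y Z) ⟩
      y * (D Y * Z + Y * D Z)
        ≈⟨ solve 5 (λ y Y Z DY DZ → y :* (DY :* Z :+ Y :* DZ) := (y :* DY) :* Z :+ y :* (Y :* DZ))
             refl y Y Z (D Y) (D Z) ⟩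
      (y * D Y) * Z + y * (Y * D Z) ≈⟨ +-cong (*-congʳ y*DY) (*-congˡ (*-congˡ DZ)) ⟩
      (fromℕ r * (z * z * Y)) * Z + y * (Y * (fromℕ s * (y * Z)))
        ≈⟨ solve 6 (λ y z Y Z K L →
             (K :* (z :* z :* Y)) :* Z :+ y :* (Y :* (L :* (y :* Z)))
             := K :* (z :* z :* (Y :* Z)) :+ L :* (y :* y :* (Y :* Z))) refl y z Y Z (fromℕ r) (fromℕ s) ⟩
      fromℕ r * (z * z * (Y * Z)) + fromℕ s * (y * y * (Y * Z)) ∎
      where
      Y = pow R y r
      Z = pow R z s
      y*DY : y * D Y ≈ fromℕ r * (z * z * Y)
      y*DY = trans (x*D-pow y r) (trans (×-congʳ r (*-congʳ D-y)) (×≈fromℕ* r _))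
      DZ : D Z ≈ fromℕ s * (y * Z)
      DZ = trans (D-pow-eigen D-z s) (×≈fromℕ* s _)

    E-monomial : ∀ r s →
      E (suc (r ℕ.+ s)) (pow R y r * pow R z s)
        ≈ w * (s × (pow R y (suc r) * pow R z s) + suc r × (pow R y r * pow R z (suc s)))
    E-monomial r s = begin
      z * z * M + fromℕ (suc (r ℕ.+ s)) * (y * z * M) + y * D M
        ≈⟨ +-cong (+-congˡ (*-congʳ (+-congˡ (×-homo-+ 1# r s)))) (y*D-monomial r s) ⟩
      z * z * M + (1# + (fromℕ r + fromℕ s)) * (y * z * M)
        + (fromℕ r * (z * z * M) + fromℕ s * (y * y * M))
        ≈⟨ solve 6 (λ y z Y Z K L →
             z :* z :* (Y :* Z) :+ (con 1 :+ (K :+ L)) :* (y :* z :* (Y :* Z))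
               :+ (K :* (z :* z :* (Y :* Z)) :+ L :* (y :* y :* (Y :* Z)))
             := (y :+ z) :* (L :* (y :* Y :* Z) :+ (con 1 :+ K) :* (Y :* (z :* Z))))
             refl y z Y Z (fromℕ r) (fromℕ s) ⟩
      w * (fromℕ s * (y * Y * Z) + fromℕ (suc r) * (Y * (z * Z)))
        ≈⟨ *-congˡ (sym (+-cong (×≈fromℕ* s _) (×≈fromℕ* (suc r) _))) ⟩
      w * (s × (y * Y * Z) + suc r × (Y * (z * Z))) ∎
      where
      Y = pow R y r
      Z = pow R z s
      M = Y * Z

    E-insertions : ∀ m π → PermShape (suc m) π →
      E (suc (suc m)) (mon (suc m) (suc (des π)))
        ≈ w * ∑ (insertions (suc (suc m)) π) (λ σ → mon (suc (suc m)) (suc (des σ)))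
    E-insertions m π (len , π<) = begin
      E (suc (suc m)) (pow R y r * pow R z (suc d))
        ≡⟨ ≡.cong (λ k → E (suc k) (pow R y r * pow R z (suc d))) (≡.sym (∸-split d≤m)) ⟩
      E (suc (r ℕ.+ suc d)) (pow R y r * pow R z (suc d))
        ≈⟨ E-monomial r (suc d) ⟩
      w * (suc d × (pow R y (suc r) * pow R z (suc d)) + suc r × (pow R y r * pow R z (suc (suc d))))
        ≡⟨ ≡.cong₂ (λ a b → w * (suc d × (pow R y a * pow R z (suc d)) + b × (pow R y r * pow R z (suc (suc d)))))
                   (≡.sym 1+m∸d≡1+r) (≡.sym (≡.trans (≡.cong (_∸ d) len) 1+m∸d≡1+r)) ⟩
      w * (suc d × mon (suc (suc m)) (suc d) + (length π ∸ d) × mon (suc (suc m)) (suc (suc d)))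
        ≈⟨ *-congˡ (sym (∑-insert-max (λ t → mon (suc (suc m)) (suc t)) (suc (suc m)) π π<)) ⟩
      w * ∑ (insertions (suc (suc m)) π) (λ σ → mon (suc (suc m)) (suc (des σ))) ∎
      where
      d = des π
      r = m ∸ d
      d≤m : d ≤ m
      d≤m = des≤ π len
      1+m∸d≡1+r : suc m ∸ d ≡ suc r
      1+m∸d≡1+r = +-∸-assoc 1 d≤m

    E-P : ∀ m → E (suc (suc m)) (P (suc m)) ≈ w * P (suc (suc m))
    E-P m = begin
      E k (∑ (perms (suc m)) f)              ≈⟨ ∑-homo (E k) (E-additive k) (E-0# k) (perms (suc m)) f ⟩
      ∑ (perms (suc m)) (λ π → E k (f π))
        ≈⟨ ∑-cong (All.map (λ {π} → E-insertions m π) (perms-shape (suc m))) ⟩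
      ∑ (perms (suc m)) (λ π → w * ∑ (insertions k π) g)
        ≈⟨ sym (∑-homo (w *_) (distribˡ w) (zeroʳ w) (perms (suc m)) _) ⟩
      w * ∑ (perms (suc m)) (λ π → ∑ (insertions k π) g)
        ≈⟨ *-congˡ (sym (∑-concatMap (insertions k) (perms (suc m)) g)) ⟩
      w * P k ∎
      where
      k = suc (suc m)
      f = λ π → mon (suc m) (suc (des π))
      g = λ σ → mon k (suc (des σ))

    Dy^-w : ∀ m → Dy^ R D y (suc m) w ≈ pow R w (suc (suc m)) * P (suc m)
    Dy^-w zero = begin
      D (y * w)                           ≈⟨ D-* y w ⟩
      D y * w + y * D w                   ≈⟨ +-cong (*-congʳ D-y) (*-congˡ D-w) ⟩
      z * z * (y + z) + y * (z * (y + z))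
        ≈⟨ solve 2 (λ y z → z :* z :* (y :+ z) :+ y :* (z :* (y :+ z))
              := ((y :+ z) :* ((y :+ z) :* con 1)) :* (con 1 :* (z :* con 1) :+ con 0)) refl y z ⟩
      pow R w 2 * P 1 ∎
    Dy^-w (suc m) = begin
      D (y * Dy^ R D y (suc m) w) ≈⟨ D-cong (*-congˡ (Dy^-w m)) ⟩
      D (y * (W * P (suc m)))     ≈⟨ Dy-on-w^k (suc (suc m)) (P (suc m)) ⟩
      W * E (suc (suc m)) (P (suc m)) ≈⟨ *-congˡ (E-P m) ⟩
      W * (w * P (suc (suc m)))   ≈⟨ x∙yz≈yx∙z W w _ ⟩
      w * W * P (suc (suc m))     ∎
      where W = pow R w (suc (suc m))

    P-eulerian : ∀ m → P (suc m) ≈ sum1 R (suc m) (λ k → scale R (eulerian (suc m) k) (mon (suc m) k))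
    P-eulerian m = ∑-by-fibres (suc m) (λ π → suc (des π)) (mon (suc m)) (perms (suc m))
      (All.map (λ {π} (len , _) → s≤s z≤n , s≤s (des≤ π len)) (perms-shape (suc m)))

mainTheorem2 : ∀ {c ℓ : Level} (R : CommutativeRing c ℓ) (δ : Derivation R)
    → let open CommutativeRing R in let open Derivation δ in
      (y z : Carrier) → D y ≈ z * z → D z ≈ y * z →
      ∀ (n : ℕ) → n ≥ 1 →
      Dy^ R D y n (y + z)
        ≈ pow R (y + z) (suc n)
          * sum1 R n (λ k → scale R (eulerian n k) (pow R y (n ∸ k) * pow R z k))
mainTheorem2 R δ y z D-y D-z (suc m) _ = trans (Dy^-w m) (*-congˡ (P-eulerian m))
  where
  open CommutativeRing R
  open TanSec R δ
  open Identities y z D-y D-z
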